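{- Let $G$ be a graph and let $H=(u,C)$ be an induced subdivision of the $1$-pan in $G$ with minimum number of vertices, where $C$ is its cycle and $u$ its vertex of degree one. If $|C|\ge 5$, then every vertex of $V(G)\setminus V(H)$ has at most one neighbor in $C$.
   Context: All graphs are finite and simple. The $1$-pan is the graph obtained from a triangle by adding a new vertex adjacent to exactly one vertex of the triangle. An induced subdivision of $H$ in $G$ is an induced subgraph of $G$ isomorphic to a graph obtained from $H$ by repeatedly replacing an edge by a path of length two through a new vertex; an induced subdivision of the $1$-pan thus consists of an induced cycle $C$ and a vertex $u$ adjacent to exactly one vertex of $C$. -}

module Defs where

open import Data.Nat using (ℕ; zero; suc; _+_; _≤_)
open import Data.Fin using (Fin; toℕ)
open import Data.Product using (Σ; _×_; _,_)
open import Data.Sum using (_⊎_)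
open import Relation.Nullary using (¬_)
open import Relation.Binary.PropositionalEquality using (_≡_)
open import Function.Bundles using (_⇔_)
open import Level using (0ℓ) renaming (suc to lsuc)

record Graph (n : ℕ) : Set₁ where
  field
    Adj     : Fin n → Fin n → Set
    sym     : ∀ {x y} → Adj x y → Adj y x
    irrefl  : ∀ {x} → ¬ Adj x x
open Graph public

Next : {k : ℕ} → Fin k → Fin k → Set
Next {k} i j = (suc (toℕ i) ≡ toℕ j) ⊎ ((suc (toℕ i) ≡ k) × (toℕ j ≡ 0))

CycAdj : {k : ℕ} → Fin k → Fin k → Set
CycAdj i j = Next i j ⊎ Next j i

-- An induced subdivision of the 1-pan in G: an induced cycle C (of length
-- len ≥ 3, listed in cyclic order as an injective map Fin len → V(G)) together
-- with a vertex u not on C adjacent to exactly one vertex of C.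
record Pan {n : ℕ} (G : Graph n) : Set where
  field
    len       : ℕ
    len≥3     : 3 ≤ len
    cyc       : Fin len → Fin n
    cyc-inj   : ∀ i j → cyc i ≡ cyc j → i ≡ j
    induced   : ∀ i j → Adj G (cyc i) (cyc j) ⇔ CycAdj i j
    u         : Fin n
    u∉C       : ∀ i → ¬ (u ≡ cyc i)
    att       : Fin len
    u-att     : Adj G u (cyc att)
    u-only    : ∀ j → Adj G u (cyc j) → j ≡ att
open Pan public

size : {n : ℕ} {G : Graph n} → Pan G → ℕ
size H = suc (len H)

MinimumPan : {n : ℕ} (G : Graph n) → Pan G → Set
MinimumPan G H = ∀ (H' : Pan G) → size H ≤ size H'

-- Let v ∉ V(H) have two neighbours on C and index C by integers modulo |C|.
-- If some vertex of C is not adjacent to v, walking along C from it we meet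
-- neighbours c_a and c_{a+d} of v with none strictly between them and c_{a−1}
-- not a neighbour; if d = |C| − 2 the complementary stretch gives such a
-- configuration with d = 2. Then v c_a … c_{a+d} is an induced cycle and
-- c_{a−1} is adjacent to c_a only, a 1-pan with d + 3 < |C| + 1 vertices.
-- If v is adjacent to all of C, a triangle through v and the attachment
-- vertex of u, with a suitable pendant vertex, is a 1-pan with 4 vertices.
-- Both contradict the minimality of H.
module Submission where

open import Data.Nat using (ℕ; _≤_)
open import Data.Fin using (Fin)
open import Relation.Nullary using (¬_)
open import Relation.Binary.PropositionalEquality using (_≡_)

open import Defs
open import Data.Nat
  using (zero; suc; _+_; _*_; _<_; _≤?_; _≟_; pred; NonZero; >-nonZero; z≤n; s≤s; s≤s⁻¹; z<s)
open import Data.Nat.Properties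
open import Data.Nat.DivMod
open import Data.Nat.Induction using (<-rec)
open import Data.Nat.Tactic.RingSolver using (solve-∀)
open import Data.Fin using (toℕ; zero; suc) renaming (_≟_ to _≟ᶠ_)
open import Data.Fin.Properties using (toℕ<n; toℕ-fromℕ<; toℕ-injective)
open import Data.Product using (_×_; _,_; ∃-syntax; ∃₂)
open import Data.Sum using (_⊎_; inj₁; inj₂; swap)
open import Data.Sum.Function.Propositional using (_⊎-⇔_)
open import Function.Base using (_∘_)
open import Function.Bundles using (_⇔_; mk⇔; Equivalence)
open import Function.Construct.Composition using (_⇔-∘_)
open import Function.Construct.Symmetry using (⇔-sym)
open import Relation.Nullary using (contradiction; yes; no)
open import Relation.Nullary.Decidable using (decidable-stable; ¬¬-excluded-middle)
open import Relation.Nullary.Negation using (¬¬-map)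
open import Relation.Binary using (tri<; tri≈; tri>)
open import Relation.Binary.PropositionalEquality
  using (_≢_; refl; trans; cong; subst; module ≡-Reasoning)
import Relation.Binary.PropositionalEquality as ≡

open Equivalence using (to; from)

private
  add-multiple : ∀ p k c → p * k + (k + c) ≡ c + k * suc p
  add-multiple = solve-∀

module Modular (L : ℕ) .{{_ : NonZero L}} where

  [m+n%L]%L≡[m+n]%L : ∀ m n → (m + n % L) % L ≡ (m + n) % L
  [m+n%L]%L≡[m+n]%L m n = begin
    (m + n % L) % L          ≡⟨ %-distribˡ-+ m (n % L) L ⟩
    (m % L + n % L % L) % L  ≡⟨ cong (λ r → (m % L + r) % L) (m%n%n≡m%n n L) ⟩
    (m % L + n % L) % L      ≡⟨ %-distribˡ-+ m n L ⟨
    (m + n) % L              ∎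
    where open ≡-Reasoning

  +-congˡ-% : ∀ k {a b} → a % L ≡ b % L → (k + a) % L ≡ (k + b) % L
  +-congˡ-% k {a} {b} eq = begin
    (k + a) % L      ≡⟨ [m+n%L]%L≡[m+n]%L k a ⟨
    (k + a % L) % L  ≡⟨ cong (λ r → (k + r) % L) eq ⟩
    (k + b % L) % L  ≡⟨ [m+n%L]%L≡[m+n]%L k b ⟩
    (k + b) % L      ∎
    where open ≡-Reasoning

  -- Adding (L − 1)·k to k + a adds a multiple of L to a.
  +-cancelˡ-% : ∀ k {a b} → (k + a) % L ≡ (k + b) % L → a % L ≡ b % L
  +-cancelˡ-% k {a} {b} eq = begin
    a % L                      ≡⟨ unshift a ⟨
    (pred L * k + (k + a)) % L ≡⟨ +-congˡ-% (pred L * k) eq ⟩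
    (pred L * k + (k + b)) % L ≡⟨ unshift b ⟩
    b % L                      ∎
    where
    open ≡-Reasoning
    unshift : ∀ c → (pred L * k + (k + c)) % L ≡ c % L
    unshift c = trans (cong (_% L) (trans (add-multiple (pred L) k c) (cong (λ l → c + k * l) (suc-pred L))))
                      ([m+kn]%n≡m%n c k L)

  %-injective-< : ∀ {a b} → a < L → b < L → a % L ≡ b % L → a ≡ b
  %-injective-< a<L b<L eq = trans (≡.sym (m<n⇒m%n≡m a<L)) (trans eq (m<n⇒m%n≡m b<L))

  SuccMod : ℕ → ℕ → Set
  SuccMod x y = y % L ≡ suc x % L

  SuccMod-resp : ∀ {x x′ y y′} → x % L ≡ x′ % L → y % L ≡ y′ % L → SuccMod x y → SuccMod x′ y′
  SuccMod-resp x≈x′ y≈y′ xy = trans (≡.sym y≈y′) (trans xy (+-congˡ-% 1 x≈x′))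

  SuccMod-+ : ∀ k {x y} → SuccMod (k + x) (k + y) ⇔ SuccMod x y
  SuccMod-+ k {x} = mk⇔
    (λ e → +-cancelˡ-% k (trans e (cong (_% L) (≡.sym (+-suc k x)))))
    (λ e → trans (+-congˡ-% k e) (cong (_% L) (+-suc k x)))

  SuccMod-below : ∀ {x y} → suc x < L → y < L → SuccMod x y ⇔ (suc x ≡ y)
  SuccMod-below 1+x<L y<L = mk⇔ (≡.sym ∘ %-injective-< y<L 1+x<L) (λ { refl → refl })

  SuccMod-top : ∀ {x y} → suc x ≡ L → y < L → SuccMod x y ⇔ (y ≡ 0)
  SuccMod-top refl y<L = mk⇔
    (λ e → trans (≡.sym (m<n⇒m%n≡m y<L)) (trans e (n%n≡0 _)))
    (λ { refl → ≡.sym (n%n≡0 _) })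

  Next⇔SuccMod : (i j : Fin L) → Next i j ⇔ SuccMod (toℕ i) (toℕ j)
  Next⇔SuccMod i j with m≤n⇒m<n∨m≡n (toℕ<n i)
  ... | inj₁ 1+i<L = mk⇔
    (λ { (inj₁ e) → from (SuccMod-below 1+i<L (toℕ<n j)) e
       ; (inj₂ (e , _)) → contradiction e (<⇒≢ 1+i<L) })
    (inj₁ ∘ to (SuccMod-below 1+i<L (toℕ<n j)))
  ... | inj₂ 1+i≡L = mk⇔
    (λ { (inj₁ e) → contradiction (trans (≡.sym e) 1+i≡L) (<⇒≢ (toℕ<n j))
       ; (inj₂ (_ , j≡0)) → from (SuccMod-top 1+i≡L (toℕ<n j)) j≡0 })
    (λ s → inj₂ (1+i≡L , to (SuccMod-top 1+i≡L (toℕ<n j)) s))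

-- Adjacency is not decidable, so least elements exist only up to double negation.
least-¬¬ : (P : ℕ → Set) → ∀ m → P m → ¬ ¬ (∃[ k ] (P k × (∀ {j} → j < k → ¬ P j)))
least-¬¬ P = <-rec _ λ m rec pm none → none (m , pm , λ j<m pj → rec j<m pj none)

record Gap (P : ℕ → Set) (p d : ℕ) : Set where
  field
    ¬before : ¬ P p
    first   : P (p + 1)
    last    : P (p + suc d)
    ¬inside : ∀ {t} → 0 < t → t < d → ¬ P (p + suc t)

Periodic : ℕ → (ℕ → Set) → Set
Periodic L P = ∀ {m} → P (m + L) ⇔ P m

ShortGap : ℕ → (ℕ → Set) → Set
ShortGap L P = ∃₂ λ p d → 1 ≤ d × 3 + d ≤ L × Gap P p d

private
  regroup : ∀ x k r b → x + suc (k + r) + suc b ≡ x + suc k + suc (r + b)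
  regroup = solve-∀
  step-first : ∀ x k → x + suc k ≡ x + k + 1
  step-first = solve-∀
  step-inside : ∀ x k j → x + suc k + suc j ≡ x + k + suc (suc j)
  step-inside = solve-∀
  wrap-first : ∀ p d → p + suc (suc d) ≡ p + suc d + 1
  wrap-first = solve-∀
  wrap-last : ∀ p d → p + 1 + suc (suc (suc d)) ≡ p + suc d + 3
  wrap-last = solve-∀
  wrap-inside : ∀ p d → p + suc d + 2 ≡ p + suc (suc (suc d))
  wrap-inside = solve-∀

  offset : ∀ {x y} → x < y → ∃[ o ] x + suc o ≡ y
  offset {x} x<y = let o , e = m≤n⇒∃[o]m+o≡n x<y in o , trans (+-suc x o) e

module _ (P : ℕ → Set) where

  next-mark : ∀ q m → P (q + suc m) →
    ¬ ¬ (∃[ k ] (k ≤ m × P (q + suc k) × (∀ {j} → j < k → ¬ P (q + suc j))))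
  next-mark q m pm = ¬¬-map
    (λ (k , pk , least) → k , ≮⇒≥ (λ m<k → least m<k pm) , pk , λ {j} → least {j})
    (least-¬¬ (λ k → P (q + suc k)) m pm)

  gap-between : ∀ x a b → ¬ P x → P (x + suc a) → P (x + suc a + suc b) →
    ¬ ¬ (∃₂ λ p d → 1 ≤ d × d ≤ a + suc b × Gap P p d)
  gap-between x a b ¬Px Pa Pb no-gap =
    next-mark x a Pa λ (k , k≤a , Pk , ¬before-k) →
    let r , k+r≡a = m≤n⇒∃[o]m+o≡n k≤a
        Pb′ = subst P (trans (cong (λ c → x + suc c + suc b) (≡.sym k+r≡a)) (regroup x k r b)) Pb
    in next-mark (x + suc k) (r + b) Pb′ λ (e , e≤r+b , Pe , ¬before-e) →
    no-gap (x + k , suc e , s≤s z≤n , bound k+r≡a e≤r+b , record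
      { ¬before = ¬before k ¬Px ¬before-k
      ; first   = subst P (step-first x k) Pk
      ; last    = subst P (step-inside x k e) Pe
      ; ¬inside = λ { {suc j} _ (s≤s j<e) → ¬before-e j<e ∘ subst P (≡.sym (step-inside x k j)) }
      })
    where
    ¬before : ∀ k → ¬ P x → (∀ {j} → j < k → ¬ P (x + suc j)) → ¬ P (x + k)
    ¬before zero    ¬Px _     = ¬Px ∘ subst P (+-identityʳ x)
    ¬before (suc j) _   below = below ≤-refl
    bound : ∀ {k r e} → k + r ≡ a → e ≤ r + b → suc e ≤ a + suc b
    bound {k} {r} refl e≤r+b = ≤-trans (s≤s e≤r+b)
      (subst (_≤ k + r + suc b) (+-suc r b) (+-monoˡ-≤ (suc b) (m≤n+m r k)))

  -- With L = d + 2 the positions p + d, …, p + d + 3 are p + d, p + d + 1, p, p + 1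
  -- modulo L: unmarked, marked, unmarked, marked.
  wrap-gap : ∀ {L p d} → Periodic L P → 2 + d ≡ L → 2 ≤ d → Gap P p d → Gap P (p + d) 2
  wrap-gap {p = p} {suc d} periodic refl (s≤s 1≤d) gap = record
    { ¬before = ¬inside 1≤d ≤-refl
    ; first   = subst P (wrap-first p d) last
    ; last    = subst P (wrap-last p d) (from periodic first)
    ; ¬inside = λ { {1} _ _ → ¬before ∘ to periodic ∘ subst P (wrap-inside p d)
                  ; {suc (suc _)} _ (s≤s (s≤s ())) }
    }
    where open Gap gap

  shorten-gap : ∀ {L p d} → 5 ≤ L → Periodic L P → 1 ≤ d → 2 + d ≤ L → Gap P p d → ShortGap L P
  shorten-gap {L} {p} {d} 5≤L periodic 1≤d 2+d≤L gap with 3 + d ≤? L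
  ... | yes short = p , d , 1≤d , short , gap
  ... | no long = p + d , 2 , s≤s z≤n , 5≤L , wrap-gap periodic 2+d≡L 2≤d gap
    where
    2+d≡L = ≤-antisym 2+d≤L (s≤s⁻¹ (≰⇒> long))
    2≤d = <⇒≤ (s≤s⁻¹ (s≤s⁻¹ (subst (5 ≤_) (≡.sym 2+d≡L) 5≤L)))

  marks-within : ∀ {L x m₁ m₂} → x < m₁ → m₁ < m₂ → m₂ < x + L → P m₁ → P m₂ →
    ∃₂ λ α β → suc α + suc β < L × P (x + suc α) × P (x + suc α + suc β)
  marks-within {L} {x} x<m₁ m₁<m₂ m₂<x+L P₁ P₂ =
    let α , x+α≡m₁ = offset x<m₁
        β , m₁+β≡m₂ = offset m₁<m₂
        x+α+β≡m₂ = trans (cong (_+ suc β) x+α≡m₁) m₁+β≡m₂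
    in α , β
     , +-cancelˡ-< x _ _
         (subst (_< x + L) (trans (≡.sym x+α+β≡m₂) (+-assoc x (suc α) (suc β))) m₂<x+L)
     , subst P (≡.sym x+α≡m₁) P₁
     , subst P (≡.sym x+α+β≡m₂) P₂

  two-marks-after : ∀ L → Periodic L P → ∀ {x a b} → x < L → a < b → b < L →
    ¬ P x → P a → P b → ∃₂ λ α β → suc α + suc β < L × P (x + suc α) × P (x + suc α + suc β)
  two-marks-after L periodic {x} {a} {b} x<L a<b b<L ¬Px Pa Pb with <-cmp x a | <-cmp x b
  ... | tri< x<a _ _ | _ = marks-within x<a a<b (<-≤-trans b<L (m≤n+m L x)) Pa Pb
  ... | tri≈ _ refl _ | _ = contradiction Pa ¬Px
  ... | tri> _ _ _ | tri≈ _ refl _ = contradiction Pb ¬Px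
  ... | tri> _ _ a<x | tri< x<b _ _ =
    marks-within x<b (<-≤-trans b<L (m≤n+m L a)) (+-monoˡ-< L a<x) Pb (from periodic Pa)
  ... | tri> _ _ a<x | tri> _ _ b<x =
    marks-within (<-≤-trans x<L (m≤n+m L a)) (+-monoˡ-< L a<b) (+-monoˡ-< L b<x)
                 (from periodic Pa) (from periodic Pb)

  short-gap-ordered : ∀ L → 5 ≤ L → Periodic L P → ∀ {x a b} → x < L → a < b → b < L →
    ¬ P x → P a → P b → ¬ ¬ ShortGap L P
  short-gap-ordered L 5≤L periodic x<L a<b b<L ¬Px Pa Pb =
    let α , β , marks<L , P₁ , P₂ = two-marks-after L periodic x<L a<b b<L ¬Px Pa Pb
    in ¬¬-map (λ (p , d , 1≤d , d≤ , gap) →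
                 shorten-gap 5≤L periodic 1≤d (<-≤-trans (s≤s (s≤s d≤)) marks<L) gap)
              (gap-between _ α β ¬Px P₁ P₂)

  short-gap : ∀ L → 5 ≤ L → Periodic L P → ∀ {x a b} → x < L → a < L → b < L → a ≢ b →
    ¬ P x → P a → P b → ¬ ¬ ShortGap L P
  short-gap L 5≤L periodic {a = a} {b} x<L a<L b<L a≢b ¬Px Pa Pb with <-cmp a b
  ... | tri< a<b _ _ = short-gap-ordered L 5≤L periodic x<L a<b b<L ¬Px Pa Pb
  ... | tri≈ _ a≡b _ = contradiction a≡b a≢b
  ... | tri> _ _ b<a = short-gap-ordered L 5≤L periodic x<L b<a a<L ¬Px Pb Pa

PathAdj : ∀ {k} → Fin k → Fin k → Set
PathAdj s t = suc (toℕ s) ≡ toℕ t ⊎ suc (toℕ t) ≡ toℕ s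

CycAdj-sym : ∀ {k} (i j : Fin k) → CycAdj i j ⇔ CycAdj j i
CycAdj-sym i j = mk⇔ swap swap

CycAdj-apex : ∀ {d} (t : Fin (suc d)) → CycAdj {suc (suc d)} zero (suc t) ⇔ (toℕ t ≡ 0 ⊎ toℕ t ≡ d)
CycAdj-apex t = mk⇔
  (λ { (inj₁ (inj₁ e)) → inj₁ (≡.sym (suc-injective e))
     ; (inj₂ (inj₂ (e , _))) → inj₂ (suc-injective (suc-injective e)) })
  (λ { (inj₁ e) → inj₁ (inj₁ (cong suc (≡.sym e)))
     ; (inj₂ e) → inj₂ (inj₂ (cong (λ m → suc (suc m)) e , refl)) })

CycAdj-path : ∀ {d} (s t : Fin (suc d)) → CycAdj {suc (suc d)} (suc s) (suc t) ⇔ PathAdj s t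
CycAdj-path s t = mk⇔
  (λ { (inj₁ (inj₁ e)) → inj₁ (suc-injective e) ; (inj₂ (inj₁ e)) → inj₂ (suc-injective e) })
  (λ { (inj₁ e) → inj₁ (inj₁ (cong suc e)) ; (inj₂ e) → inj₂ (inj₁ (cong suc e)) })

module _ {n : ℕ} (G : Graph n) where

  Adj-sym : ∀ {x y} → Adj G x y ⇔ Adj G y x
  Adj-sym = mk⇔ (sym G) (sym G)

  Adj⇒≢ : ∀ {x y} → Adj G x y → x ≢ y
  Adj⇒≢ xy refl = irrefl G xy

  record InducedPath (d : ℕ) : Set where
    field
      vertex    : Fin (suc d) → Fin n
      injective : ∀ s t → vertex s ≡ vertex t → s ≡ t
      adjacent  : ∀ s t → Adj G (vertex s) (vertex t) ⇔ PathAdj s t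

  edge-path : ∀ {x y} → Adj G x y → InducedPath 1
  edge-path {x} {y} xy = record { vertex = vertex ; injective = injective ; adjacent = adjacent }
    where
    vertex : Fin 2 → Fin n
    vertex zero       = x
    vertex (suc zero) = y
    injective : ∀ s t → vertex s ≡ vertex t → s ≡ t
    injective zero       zero       _ = refl
    injective zero       (suc zero) e = contradiction e (Adj⇒≢ xy)
    injective (suc zero) zero       e = contradiction (≡.sym e) (Adj⇒≢ xy)
    injective (suc zero) (suc zero) _ = refl
    adjacent : ∀ s t → Adj G (vertex s) (vertex t) ⇔ PathAdj s t
    adjacent zero       zero       = mk⇔ (λ a → contradiction a (irrefl G)) λ { (inj₁ ()) ; (inj₂ ()) }
    adjacent zero       (suc zero) = mk⇔ (λ _ → inj₁ refl) (λ _ → xy)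
    adjacent (suc zero) zero       = mk⇔ (λ _ → inj₂ refl) (λ _ → sym G xy)
    adjacent (suc zero) (suc zero) = mk⇔ (λ a → contradiction a (irrefl G)) λ { (inj₁ ()) ; (inj₂ ()) }

  record ApexClosure (d : ℕ) : Set where
    field
      path      : InducedPath d
    open InducedPath path
    field
      apex      : Fin n
      apex∉path : ∀ t → apex ≢ vertex t
      apex-adj  : ∀ t → Adj G apex (vertex t) ⇔ (toℕ t ≡ 0 ⊎ toℕ t ≡ d)
      tail      : Fin n
      tail≢apex : tail ≢ apex
      tail∉path : ∀ t → tail ≢ vertex t
      tail≁apex : ¬ Adj G tail apex
      tail-adj  : Adj G tail (vertex zero)
      tail-only : ∀ t → Adj G tail (vertex t) → t ≡ zero

  closure-pan : ∀ {d} → 1 ≤ d → ApexClosure d → Pan G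
  closure-pan {d} 1≤d A = record
    { len = suc (suc d) ; len≥3 = s≤s (s≤s 1≤d)
    ; cyc = cycle ; cyc-inj = cycle-injective ; induced = cycle-induced
    ; u = tail ; u∉C = tail∉cycle ; att = suc zero ; u-att = tail-adj ; u-only = tail-only-cycle }
    where
    open ApexClosure A
    open InducedPath path

    cycle : Fin (suc (suc d)) → Fin n
    cycle zero    = apex
    cycle (suc t) = vertex t

    cycle-injective : ∀ i j → cycle i ≡ cycle j → i ≡ j
    cycle-injective zero    zero    _ = refl
    cycle-injective zero    (suc t) e = contradiction e (apex∉path t)
    cycle-injective (suc s) zero    e = contradiction (≡.sym e) (apex∉path s)
    cycle-injective (suc s) (suc t) e = cong suc (injective s t e)

    cycle-induced : ∀ i j → Adj G (cycle i) (cycle j) ⇔ CycAdj i j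
    cycle-induced zero    zero    = mk⇔ (λ a → contradiction a (irrefl G))
      (λ { (inj₁ (inj₁ ())) ; (inj₁ (inj₂ ())) ; (inj₂ (inj₁ ())) ; (inj₂ (inj₂ ())) })
    cycle-induced zero    (suc t) = ⇔-sym (CycAdj-apex t) ⇔-∘ apex-adj t
    cycle-induced (suc s) zero    = CycAdj-sym zero (suc s) ⇔-∘ (cycle-induced zero (suc s) ⇔-∘ Adj-sym)
    cycle-induced (suc s) (suc t) = ⇔-sym (CycAdj-path s t) ⇔-∘ adjacent s t

    tail∉cycle : ∀ i → tail ≢ cycle i
    tail∉cycle zero    = tail≢apex
    tail∉cycle (suc t) = tail∉path t

    tail-only-cycle : ∀ i → Adj G tail (cycle i) → i ≡ suc zero
    tail-only-cycle zero    a = contradiction a tail≁apex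
    tail-only-cycle (suc t) a = cong suc (tail-only t a)

  triangle-pan : ∀ {x y z w} → Adj G x y → Adj G y z → Adj G z x →
    Adj G w x → ¬ Adj G w y → ¬ Adj G w z → Pan G
  triangle-pan {x} {y} {z} {w} xy yz zx wx ¬wy ¬wz = closure-pan ≤-refl record
    { path      = edge-path xy
    ; apex      = z
    ; apex∉path = λ { zero → Adj⇒≢ zx ; (suc zero) → Adj⇒≢ (sym G yz) }
    ; apex-adj  = λ { zero → mk⇔ (λ _ → inj₁ refl) (λ _ → zx)
                    ; (suc zero) → mk⇔ (λ _ → inj₂ refl) (λ _ → sym G yz) }
    ; tail      = w
    ; tail≢apex = λ { refl → ¬wy (sym G yz) }
    ; tail∉path = λ { zero → Adj⇒≢ wx ; (suc zero) refl → ¬wz yz }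
    ; tail≁apex = ¬wz
    ; tail-adj  = wx
    ; tail-only = λ { zero _ → refl ; (suc zero) wy → contradiction wy ¬wy }
    }

module Positions {n : ℕ} {G : Graph n} (H : Pan G) where

  instance
    len-nonZero : NonZero (len H)
    len-nonZero = >-nonZero (≤-trans (s≤s z≤n) (len≥3 H))

  open Modular (len H) public

  at : ℕ → Fin n
  at m = cyc H (m mod len H)

  toℕ-mod : ∀ m → toℕ (m mod len H) ≡ m % len H
  toℕ-mod m = toℕ-fromℕ< (m%n<n m (len H))

  at-cong : ∀ {m m′} → m % len H ≡ m′ % len H → at m ≡ at m′
  at-cong {m} {m′} eq =
    cong (cyc H) (toℕ-injective (trans (toℕ-mod m) (trans eq (≡.sym (toℕ-mod m′)))))

  at-injective : ∀ {m m′} → at m ≡ at m′ → m % len H ≡ m′ % len H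
  at-injective {m} {m′} eq =
    trans (≡.sym (toℕ-mod m)) (trans (cong toℕ (cyc-inj H _ _ eq)) (toℕ-mod m′))

  at-+-injective : ∀ k {x y} → at (k + x) ≡ at (k + y) → x % len H ≡ y % len H
  at-+-injective k = +-cancelˡ-% k ∘ at-injective

  at-toℕ : ∀ i → at (toℕ i) ≡ cyc H i
  at-toℕ i = cong (cyc H) (toℕ-injective (trans (toℕ-mod (toℕ i)) (m<n⇒m%n≡m (toℕ<n i))))

  Adj-at-periodic : ∀ {z} → Periodic (len H) (λ m → Adj G z (at m))
  Adj-at-periodic {z} {m} = mk⇔ (subst (Adj G z) periodic) (subst (Adj G z) (≡.sym periodic))
    where periodic = at-cong ([m+n]%n≡m%n m (len H))

  Next-mod : ∀ x y → Next (x mod len H) (y mod len H) ⇔ SuccMod x y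
  Next-mod x y = mk⇔
    (λ next → SuccMod-resp (residue x) (residue y) (to (Next⇔SuccMod _ _) next))
    (λ s → from (Next⇔SuccMod _ _) (SuccMod-resp (≡.sym (residue x)) (≡.sym (residue y)) s))
    where
    residue : ∀ m → toℕ (m mod len H) % len H ≡ m % len H
    residue m = trans (cong (_% len H) (toℕ-mod m)) (m%n%n≡m%n m (len H))

  Adj-at-+ : ∀ k x y → Adj G (at (k + x)) (at (k + y)) ⇔ (SuccMod x y ⊎ SuccMod y x)
  Adj-at-+ k x y =
    (SuccMod-+ k ⊎-⇔ SuccMod-+ k) ⇔-∘ ((Next-mod _ _ ⊎-⇔ Next-mod _ _) ⇔-∘ induced H _ _)

  at-+0 : ∀ k → at k ≡ at (k + 0)
  at-+0 k = cong at (≡.sym (+-identityʳ k))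

  Adj-at-suc : ∀ k → Adj G (at k) (at (k + 1))
  Adj-at-suc k = subst (λ w → Adj G w (at (k + 1))) (≡.sym (at-+0 k)) (from (Adj-at-+ k 0 1) (inj₁ refl))

  at-+suc-≢ : ∀ k {t} → suc t < len H → at k ≢ at (k + suc t)
  at-+suc-≢ k t<L e =
    0≢1+n (%-injective-< (<-trans z<s t<L) t<L (at-+-injective k (trans (≡.sym (at-+0 k)) e)))

  Adj-at-+suc : ∀ k {t} → suc (suc t) < len H → Adj G (at k) (at (k + suc t)) → t ≡ 0
  Adj-at-+suc k {t} t<L a with to (Adj-at-+ k 0 (suc t)) (subst (λ w → Adj G w (at (k + suc t))) (at-+0 k) a)
  ... | inj₁ s = ≡.sym (suc-injective (to (SuccMod-below (≤-trans (s≤s (s≤s z≤n)) t<L) (<⇒≤ t<L)) s))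
  ... | inj₂ s with () ← to (SuccMod-below t<L (≤-trans (s≤s z≤n) t<L)) s

  consecutive-path : ∀ k {d} → 3 + d ≤ len H → InducedPath G d
  consecutive-path k {d} short = record
    { vertex    = λ t → at (k + suc (toℕ t))
    ; injective = λ s t → toℕ-injective ∘ suc-injective
                          ∘ %-injective-< (<⇒≤ (inner s)) (<⇒≤ (inner t)) ∘ at-+-injective k
    ; adjacent  = λ s t →
        (suc≡suc⇔ ⊎-⇔ suc≡suc⇔)
        ⇔-∘ ((SuccMod-below (inner s) (<⇒≤ (inner t)) ⊎-⇔ SuccMod-below (inner t) (<⇒≤ (inner s)))
             ⇔-∘ Adj-at-+ k _ _)
    }
    where
    suc≡suc⇔ : ∀ {a b} → suc a ≡ suc b ⇔ a ≡ b
    suc≡suc⇔ = mk⇔ suc-injective (cong suc)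
    inner : (t : Fin (suc d)) → suc (suc (toℕ t)) < len H
    inner t = ≤-trans (s≤s (s≤s (toℕ<n t))) short

  u-at : Adj G (u H) (at (toℕ (att H)))
  u-at = subst (Adj G (u H)) (≡.sym (at-toℕ (att H))) (u-att H)

  u-only-at : ∀ {t} → suc t < len H → ¬ Adj G (u H) (at (toℕ (att H) + suc t))
  u-only-at t<L a = at-+suc-≢ _ t<L (trans (at-toℕ (att H)) (≡.sym (cong (cyc H) (u-only H _ a))))

module _ {n : ℕ} {G : Graph n} (H : Pan G) (minH : MinimumPan G H) where

  open Positions H

  no-shorter-pan : (K : Pan G) → ¬ (len K < len H)
  no-shorter-pan K K<H = <⇒≱ K<H (s≤s⁻¹ (minH K))

  module _ {v : Fin n} (v∉C : ∀ m → v ≢ at m) where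

    gap-closure : ∀ {p d} → 3 + d ≤ len H → Gap (λ m → Adj G v (at m)) p d → ApexClosure G d
    gap-closure {p} {d} short gap = record
      { path      = consecutive-path p short
      ; apex      = v
      ; apex∉path = λ t → v∉C (p + suc (toℕ t))
      ; apex-adj  = λ t → mk⇔ (ends (toℕ t) (bound t)) λ { (inj₁ e) → subst N′ (≡.sym e) first
                                                         ; (inj₂ e) → subst N′ (≡.sym e) last }
      ; tail      = at p
      ; tail≢apex = v∉C p ∘ ≡.sym
      ; tail∉path = λ t → at-+suc-≢ p (≤-trans (s≤s (s≤s (bound t))) (<⇒≤ short))
      ; tail≁apex = ¬before ∘ sym G
      ; tail-adj  = Adj-at-suc p
      ; tail-only = λ t → toℕ-injective ∘ Adj-at-+suc p (≤-trans (s≤s (s≤s (s≤s (bound t)))) short)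
      }
      where
      open Gap gap

      N′ : ℕ → Set
      N′ t = Adj G v (at (p + suc t))

      bound : (t : Fin (suc d)) → toℕ t ≤ d
      bound t = s≤s⁻¹ (toℕ<n t)

      ends : ∀ t → t ≤ d → N′ t → t ≡ 0 ⊎ t ≡ d
      ends zero    _   _ = inj₁ refl
      ends (suc t) t<d a with suc t ≟ d
      ... | yes t≡d = inj₂ t≡d
      ... | no  t≢d = contradiction a (¬inside z<s (≤∧≢⇒< t<d t≢d))

    no-short-gap : ¬ ShortGap (len H) (λ m → Adj G v (at m))
    no-short-gap (_ , _ , 1≤d , short , gap) =
      no-shorter-pan (closure-pan G 1≤d (gap-closure short gap)) short

  -- With c_k = at (α + k) for the attachment α of u: if u ~ v, the triangle
  -- v u c₀ with pendant c₂; otherwise the triangle c₀ c₁ v with pendant u.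
  not-adjacent-to-all : 4 ≤ len H → ∀ {v} → ¬ (∀ m → ¬ ¬ Adj G v (at m))
  not-adjacent-to-all 4≤L {v} everywhere =
    everywhere α λ v₀ → everywhere (α + 1) λ v₁ → everywhere (α + 2) λ v₂ →
    ¬¬-excluded-middle λ
      { (yes uv) → no-shorter-pan
          (triangle-pan G (sym G uv) u-at (sym G v₀) (sym G v₂) (u-only-at 2<L ∘ sym G) c₂≁c₀) 4≤L
      ; (no ¬uv) → no-shorter-pan
          (triangle-pan G (Adj-at-suc α) (sym G v₁) v₀ u-at (u-only-at 1<L) ¬uv) 4≤L
      }
    where
    α = toℕ (att H)
    1<L : 1 < len H
    1<L = ≤-trans (s≤s (s≤s z≤n)) 4≤L
    2<L : 2 < len H
    2<L = ≤-trans (s≤s (s≤s (s≤s z≤n))) 4≤L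
    c₂≁c₀ : ¬ Adj G (at (α + 2)) (at α)
    c₂≁c₀ a with () ← Adj-at-+suc α 4≤L (sym G a)

lemma8p3 : ∀ {n : ℕ} (G : Graph n) (H : Pan G) → MinimumPan G H → 5 ≤ len H →
    ∀ (v : Fin n) → ¬ (v ≡ u H) → (∀ i → ¬ (v ≡ cyc H i)) →
    ∀ (i j : Fin (len H)) → Adj G v (cyc H i) → Adj G v (cyc H j) → i ≡ j
lemma8p3 G H minH 5≤L v _ v∉C i j vi vj = decidable-stable (i ≟ᶠ j) λ i≢j →
  not-adjacent-to-all H minH (≤-trans (n≤1+n 4) 5≤L) λ m v≁m →
  short-gap N (len H) 5≤L Adj-at-periodic (m%n<n m (len H)) (toℕ<n i) (toℕ<n j) (i≢j ∘ toℕ-injective)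
    (v≁m ∘ subst (Adj G v) (at-cong (m%n%n≡m%n m (len H)))) (neighbour vi) (neighbour vj)
    (no-short-gap H minH (v∉C ∘ (_mod len H)))
  where
  open Positions H

  N : ℕ → Set
  N m = Adj G v (at m)

  neighbour : ∀ {k} → Adj G v (cyc H k) → N (toℕ k)
  neighbour = subst (Adj G v) (≡.sym (at-toℕ _))
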